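{- $\mathrm{Points}$, with the actions described below, is an amgis-algebra over the termlike $\sigma$-algebra of terms, and it is exact.
   Context: Atoms $\mathbb A$ countably infinite ($a,b,c$ distinct); permutations, swappings $(a\ b)$, nominal support, $a\#x$ for $a\notin\mathrm{supp}(x)$, $\mathsf N c$ = "for all but finitely many $c$". Terms $r::=a\mid\mathsf f(r_1..r_n)$ over a signature form a termlike $\sigma$-algebra under real substitution $r[a:=s]$ (with atoms included as terms). Predicates of first-order logic with equality, up to $\alpha$-equivalence, with capture-avoiding substitution; $\vdash$ is derivability in the standard classical sequent calculus with equality; $\phi\vee\psi=\neg(\neg\phi\wedge\neg\psi)$. A filter is a nonempty set $p$ of predicates with $\bot\notin p$, deductively closed, closed under $\wedge$, and such that $\mathsf N b.\,(b\ a)\cdot\phi\in p$ implies $\forall a.\phi\in p$; prime if $\phi_1\vee\phi_2\in p$ implies $\phi_1\in p$ or $\phi_2\in p$. $\mathrm{Points}$ is the set of prime filters, with $\pi\cdot p=\{\pi\cdot\phi\mid\phi\in p\}$ and $p[r\Leftarrow a]=\{\phi\mid\phi[a:=r]\in p\}$. An amgis-algebra over a termlike $\sigma$-algebra $\mathsf U$ is a set $\mathsf P$ with a permutation action and an equivariant map $\mathsf P\times\mathsf U\times\mathbb A\to\mathsf P$, $p[u\Leftarrow a]$, such that $a\#v$ implies $p[v\Leftarrow b][u\Leftarrow a]=p[u[b:=v]\Leftarrow a][v\Leftarrow b]$. It is exact if $\mathsf N c.\,p[u\Leftarrow c]=q[u\Leftarrow c]$ implies $p=q$. -}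

module Defs where

open import Level using (Level; _⊔_) renaming (suc to lsuc; zero to lzero)
open import Data.Nat using (ℕ; zero; suc; _≡ᵇ_)
open import Data.Fin using (Fin; zero; suc)
open import Data.Vec using (Vec; []; _∷_)
open import Data.List using (List; []; _∷_; _++_; concatMap)
open import Data.List.Membership.Propositional using (_∈_; _∉_)
open import Data.List.Membership.Propositional.Properties using (∈-++⁺ˡ; ∈-++⁺ʳ)
open import Data.Product using (Σ; ∃; _×_; _,_; proj₁; proj₂)
open import Data.Bool using (if_then_else_)
open import Data.Sum using (_⊎_)
open import Relation.Nullary using (¬_)
open import Relation.Binary.PropositionalEquality using (_≡_; refl; trans; cong)
open import Relation.Binary.Structures using (IsEquivalence)

Atom : Set
Atom = ℕ

-- "N c. P c": for all but finitely many atoms c.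
N : (Atom → Set) → Set
N P = Σ (List Atom) λ L → ∀ c → c ∉ L → P c

swap : Atom → Atom → Atom → Atom
swap b a c = if c ≡ᵇ b then a else (if c ≡ᵇ a then b else c)

record Perm : Set where
  field
    to      : Atom → Atom
    from    : Atom → Atom
    from-to : ∀ a → from (to a) ≡ a
    to-from : ∀ a → to (from a) ≡ a
    supp    : List Atom
    fixes   : ∀ a → a ∉ supp → to a ≡ a
open Perm public

idPerm : Perm
idPerm = record { to = λ a → a ; from = λ a → a ; from-to = λ _ → refl
                ; to-from = λ _ → refl ; supp = [] ; fixes = λ _ _ → refl }

_∘ₚ_ : Perm → Perm → Perm
π ∘ₚ π' = record
  { to = λ a → to π (to π' a)
  ; from = λ a → from π' (from π a)
  ; from-to = λ a → trans (cong (from π') (from-to π (to π' a))) (from-to π' a)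
  ; to-from = λ a → trans (cong (to π) (to-from π' (from π a))) (to-from π a)
  ; supp = supp π ++ supp π'
  ; fixes = λ a a∉ → trans (cong (to π) (fixes π' a (λ m → a∉ (∈-++⁺ʳ (supp π) m))))
                           (fixes π a (λ m → a∉ (∈-++⁺ˡ m)))
  }

record Signature : Set₁ where
  field
    Fun    : Set
    fArity : Fun → ℕ
    Rel    : Set
    rArity : Rel → ℕ

-- Syntax over a signature, locally nameless: atoms are the (free)
-- names, bound variables are well-scoped de Bruijn indices.  Hence
-- predicates up to α-equivalence are exactly elements of Formula 0,
-- and terms r ::= a | f(r1..rn) are exactly elements of Term 0.

module Syntax (S : Signature) where
  open Signature S

  data Term (n : ℕ) : Set where
    var : Fin n → Term n
    atm : Atom → Term n
    fun : (f : Fun) → Vec (Term n) (fArity f) → Term n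

  data Formula (n : ℕ) : Set where
    _≐_  : Term n → Term n → Formula n
    rel  : (R : Rel) → Vec (Term n) (rArity R) → Formula n
    ⊥'   : Formula n
    ¬'_  : Formula n → Formula n
    _∧'_ : Formula n → Formula n → Formula n
    ∀'   : Formula (suc n) → Formula n

  _∨'_ : ∀ {n} → Formula n → Formula n → Formula n
  φ ∨' ψ = ¬' ((¬' φ) ∧' (¬' ψ))

  mutual
    substT : ∀ {n m} → (Atom → Term m) → (Fin n → Term m) → Term n → Term m
    substT ρ σ (var i) = σ i
    substT ρ σ (atm a) = ρ a
    substT ρ σ (fun f ts) = fun f (substTs ρ σ ts)

    substTs : ∀ {n m k} → (Atom → Term m) → (Fin n → Term m) → Vec (Term n) k → Vec (Term m) k
    substTs ρ σ [] = []
    substTs ρ σ (t ∷ ts) = substT ρ σ t ∷ substTs ρ σ ts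

  wk : ∀ {m} → Term m → Term (suc m)
  wk = substT atm (λ i → var (suc i))

  lift : ∀ {n m} → (Fin n → Term m) → Fin (suc n) → Term (suc m)
  lift σ zero = var zero
  lift σ (suc i) = wk (σ i)

  substF : ∀ {n m} → (Atom → Term m) → (Fin n → Term m) → Formula n → Formula m
  substF ρ σ (t ≐ u) = substT ρ σ t ≐ substT ρ σ u
  substF ρ σ (rel R ts) = rel R (substTs ρ σ ts)
  substF ρ σ ⊥' = ⊥'
  substF ρ σ (¬' φ) = ¬' substF ρ σ φ
  substF ρ σ (φ ∧' ψ) = substF ρ σ φ ∧' substF ρ σ ψ
  substF ρ σ (∀' φ) = ∀' (substF (λ a → wk (ρ a)) (lift σ) φ)

  inj : ∀ {m} → Term 0 → Term m
  inj = substT atm (λ ())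

  at : ∀ {m} → Atom → Term 0 → Atom → Term m
  at a s c = if c ≡ᵇ a then inj s else atm c

  _[_≔_]ᵗ : Term 0 → Atom → Term 0 → Term 0
  r [ a ≔ s ]ᵗ = substT (at a s) var r

  _·ᵗ_ : Perm → Term 0 → Term 0
  π ·ᵗ r = substT (λ c → atm (to π c)) var r

  _·ᶠ_ : Perm → Formula 0 → Formula 0
  π ·ᶠ φ = substF (λ c → atm (to π c)) var φ

  swapF : Atom → Atom → Formula 0 → Formula 0
  swapF b a φ = substF (λ c → atm (swap b a c)) var φ

  -- capture-avoiding substitution φ[a:=r] (capture is impossible in
  -- the locally nameless representation)
  _[_≔_]ᶠ : Formula 0 → Atom → Term 0 → Formula 0
  φ [ a ≔ r ]ᶠ = substF (at a r) var φ

  ∀[_]_ : Atom → Formula 0 → Formula 0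
  ∀[ a ] φ = ∀' (substF (λ c → if c ≡ᵇ a then var zero else atm c) (λ ()) φ)

  open₀ : Term 0 → Formula 1 → Formula 0
  open₀ r φ = substF atm (λ { zero → r }) φ

  mutual
    atomsT : ∀ {n} → Term n → List Atom
    atomsT (var i) = []
    atomsT (atm a) = a ∷ []
    atomsT (fun f ts) = atomsTs ts

    atomsTs : ∀ {n k} → Vec (Term n) k → List Atom
    atomsTs [] = []
    atomsTs (t ∷ ts) = atomsT t ++ atomsTs ts

  atomsF : ∀ {n} → Formula n → List Atom
  atomsF (t ≐ u) = atomsT t ++ atomsT u
  atomsF (rel R ts) = atomsTs ts
  atomsF ⊥' = []
  atomsF (¬' φ) = atomsF φ
  atomsF (φ ∧' ψ) = atomsF φ ++ atomsF ψ
  atomsF (∀' φ) = atomsF φ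

  _#ᵗ_ : Atom → Term 0 → Set
  a #ᵗ r = a ∉ atomsT r

  -- Classical sequent calculus LK with equality (structural rules
  -- weakening / contraction / exchange packaged as list inclusion).

  Ctx : Set
  Ctx = List (Formula 0)

  _⊆_ : Ctx → Ctx → Set
  Γ ⊆ Γ' = ∀ {φ} → φ ∈ Γ → φ ∈ Γ'

  infix 3 _⊢_
  data _⊢_ : Ctx → Ctx → Set where
    ax   : ∀ {φ} → φ ∷ [] ⊢ φ ∷ []
    str  : ∀ {Γ Γ' Δ Δ'} → Γ ⊆ Γ' → Δ ⊆ Δ' → Γ ⊢ Δ → Γ' ⊢ Δ'
    cut  : ∀ {Γ Δ φ} → Γ ⊢ φ ∷ Δ → φ ∷ Γ ⊢ Δ → Γ ⊢ Δ
    ⊥L   : ∀ {Γ Δ} → ⊥' ∷ Γ ⊢ Δ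
    ¬L   : ∀ {Γ Δ φ} → Γ ⊢ φ ∷ Δ → (¬' φ) ∷ Γ ⊢ Δ
    ¬R   : ∀ {Γ Δ φ} → φ ∷ Γ ⊢ Δ → Γ ⊢ (¬' φ) ∷ Δ
    ∧L   : ∀ {Γ Δ φ ψ} → φ ∷ ψ ∷ Γ ⊢ Δ → (φ ∧' ψ) ∷ Γ ⊢ Δ
    ∧R   : ∀ {Γ Δ φ ψ} → Γ ⊢ φ ∷ Δ → Γ ⊢ ψ ∷ Δ → Γ ⊢ (φ ∧' ψ) ∷ Δ
    ∀L   : ∀ {Γ Δ φ} (r : Term 0) → open₀ r φ ∷ Γ ⊢ Δ → ∀' φ ∷ Γ ⊢ Δ
    ∀R   : ∀ {Γ Δ φ} (a : Atom) → a ∉ concatMap atomsF Γ → a ∉ concatMap atomsF Δ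
           → a ∉ atomsF (∀' φ) → Γ ⊢ open₀ (atm a) φ ∷ Δ → Γ ⊢ ∀' φ ∷ Δ
    =R   : ∀ {Γ Δ} (r : Term 0) → Γ ⊢ (r ≐ r) ∷ Δ
    =sub : ∀ {Γ Δ} (φ : Formula 1) (r s : Term 0)
           → Γ ⊢ (r ≐ s) ∷ Δ → Γ ⊢ open₀ r φ ∷ Δ → Γ ⊢ open₀ s φ ∷ Δ

  PSet : Set₁
  PSet = Formula 0 → Set

  record IsFilter (p : PSet) : Set where
    field
      nonempty : Σ (Formula 0) p
      no-⊥     : ¬ p ⊥'
      ded      : ∀ φ ψ → p φ → (φ ∷ [] ⊢ ψ ∷ []) → p ψ
      ∧-closed : ∀ φ ψ → p φ → p ψ → p (φ ∧' ψ)
      ∀-closed : ∀ a φ → N (λ b → p (swapF b a φ)) → p (∀[ a ] φ)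

  record IsPrimeFilter (p : PSet) : Set where
    field
      isFilter : IsFilter p
      prime    : ∀ φ₁ φ₂ → p (φ₁ ∨' φ₂) → p φ₁ ⊎ p φ₂

  Point : Set₁
  Point = Σ PSet IsPrimeFilter

  _·ₚ_ : Perm → PSet → PSet
  (π ·ₚ p) ψ = Σ (Formula 0) λ φ → p φ × (ψ ≡ π ·ᶠ φ)

  _[_⇐_]ₚ : PSet → Term 0 → Atom → PSet
  (p [ r ⇐ a ]ₚ) φ = p (φ [ a ≔ r ]ᶠ)

  PointsClosed : Set₁
  PointsClosed = (∀ π p → IsPrimeFilter p → IsPrimeFilter (π ·ₚ p))
               × (∀ p r a → IsPrimeFilter p → IsPrimeFilter (p [ r ⇐ a ]ₚ))

  _≈ₚ_ : Point → Point → Set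
  p ≈ₚ q = ∀ φ → (proj₁ p φ → proj₁ q φ) × (proj₁ q φ → proj₁ p φ)

  record AmgisData : Set₂ where
    field
      Carrier : Set₁
      _≈_     : Carrier → Carrier → Set
      _∙_     : Perm → Carrier → Carrier
      _[_⇐_]  : Carrier → Term 0 → Atom → Carrier

  record IsAmgisAlgebra (D : AmgisData) : Set₁ where
    open AmgisData D
    field
      isEquivalence : IsEquivalence _≈_
      ∙-cong     : ∀ π {p q} → p ≈ q → (π ∙ p) ≈ (π ∙ q)
      ⇐-cong     : ∀ {p q} u a → p ≈ q → (p [ u ⇐ a ]) ≈ (q [ u ⇐ a ])
      ∙-id       : ∀ p → (idPerm ∙ p) ≈ p
      ∙-comp     : ∀ π π' p → ((π ∘ₚ π') ∙ p) ≈ (π ∙ (π' ∙ p))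
      equivar    : ∀ π p u a → (π ∙ (p [ u ⇐ a ])) ≈ ((π ∙ p) [ π ·ᵗ u ⇐ to π a ])
      amgis      : ∀ p u v a b → ¬ (a ≡ b) → a #ᵗ v
                   → ((p [ v ⇐ b ]) [ u ⇐ a ]) ≈ ((p [ u [ b ≔ v ]ᵗ ⇐ a ]) [ v ⇐ b ])

  IsExact : AmgisData → Set₁
  IsExact D = ∀ p q u → N (λ c → (p [ u ⇐ c ]) ≈ (q [ u ⇐ c ])) → p ≈ q
    where open AmgisData D

  PointsData : PointsClosed → AmgisData
  PointsData cl = record
    { Carrier = Point
    ; _≈_ = _≈ₚ_
    ; _∙_ = λ π p → (π ·ₚ proj₁ p) , proj₁ cl π (proj₁ p) (proj₂ p)
    ; _[_⇐_] = λ p r a → (proj₁ p [ r ⇐ a ]ₚ) , proj₂ cl (proj₁ p) r a (proj₂ p)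
    }

module Submission where

-- On the logical side, derivability of φ ⊢ ψ is
-- stable under permutations (induction on derivations) and under φ[a:=r]
-- (generalise ∀a.(φ → ψ), then instantiate at r).  Hence the pullback of a
-- prime filter along such a substitution is again a prime filter, which gives
-- closure of Points under both actions; the amgis-algebra laws and exactness are
-- then the syntactic identities read through membership.

open import Defs
open import Function using (_∘_)
open import Data.Product using (Σ; _×_; _,_; proj₁; proj₂)
open import Data.Nat using (suc; _≡ᵇ_)
open import Data.Nat.Properties using (≡ᵇ⇒≡; ≡⇒≡ᵇ; 1+n≰n; _≟_)
open import Data.Fin using (Fin; zero; suc)
open import Data.Vec using (Vec; []; _∷_)
open import Data.List using (List; []; _∷_; _++_; concatMap; map)
open import Data.List.Extrema.Nat using (max; xs≤max)
open import Data.List.Relation.Unary.All using (lookup)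
open import Data.List.Relation.Unary.Any using (here; there)
open import Data.List.Membership.Propositional using (_∈_; _∉_)
open import Data.List.Membership.Propositional.Properties using (∈-++⁺ˡ; ∈-++⁺ʳ; ∈-++⁻; ∈-map⁺)
open import Data.List.Relation.Binary.Subset.Propositional.Properties using (⊆-refl; xs⊆xs++ys; map⁺; ⊆-reflexive-↭)
open import Data.List.Relation.Binary.Permutation.Propositional using (↭-refl) renaming (swap to ↭-swap)
open import Data.Bool using (true; false; if_then_else_)
open import Data.Sum using (inj₁; inj₂) renaming (map to ⊎-map)
open import Data.Empty using (⊥-elim)
open import Relation.Nullary using (yes; no)
open import Relation.Binary.PropositionalEquality using (_≡_; _≢_; refl; sym; trans; cong; cong₂; subst; ≢-sym; module ≡-Reasoning)
open import Relation.Binary.Structures using (IsEquivalence)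
import Relation.Binary.Construct.On as On

if-≡ᵇ-refl : ∀ {A : Set} (a : Atom) {x y : A} → (if a ≡ᵇ a then x else y) ≡ x
if-≡ᵇ-refl a with a ≡ᵇ a | ≡⇒≡ᵇ a a refl
... | true  | _  = refl
... | false | ()

if-≡ᵇ-no : ∀ {A : Set} {c a : Atom} {x y : A} → c ≢ a → (if c ≡ᵇ a then x else y) ≡ y
if-≡ᵇ-no {c = c} {a} c≢a with c ≡ᵇ a | ≡ᵇ⇒≡ c a
... | false | _     = refl
... | true  | sound = ⊥-elim (c≢a (sound _))

swap-left : ∀ b a → swap b a b ≡ a
swap-left b a = if-≡ᵇ-refl b

swap-right : ∀ b a → swap b a a ≡ b
swap-right b a with a ≟ b
... | yes refl = swap-left a a
... | no a≢b   = trans (if-≡ᵇ-no a≢b) (if-≡ᵇ-refl a)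

swap-fixes : ∀ b a c → c ≢ b → c ≢ a → swap b a c ≡ c
swap-fixes b a c c≢b c≢a = trans (if-≡ᵇ-no c≢b) (if-≡ᵇ-no c≢a)

swap-involutive : ∀ b a c → swap b a (swap b a c) ≡ c
swap-involutive b a c with c ≟ b | c ≟ a
... | yes refl | _        = trans (cong (swap c a) (swap-left c a)) (swap-right c a)
... | no _     | yes refl = trans (cong (swap b c) (swap-right b c)) (swap-left b c)
... | no c≢b   | no c≢a   = trans (cong (swap b a) (swap-fixes b a c c≢b c≢a)) (swap-fixes b a c c≢b c≢a)

swapPerm : Atom → Atom → Perm
swapPerm b a = record
  { to = swap b a ; from = swap b a
  ; from-to = swap-involutive b a ; to-from = swap-involutive b a
  ; supp = b ∷ a ∷ []
  ; fixes = λ c c∉ → swap-fixes b a c (c∉ ∘ here) (c∉ ∘ there ∘ here) }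

fresh : List Atom → Atom
fresh L = suc (max 0 L)

fresh-∉ : ∀ L → fresh L ∉ L
fresh-∉ L m = 1+n≰n (lookup (xs≤max 0 L) m)

∈-∉-≢ : ∀ {x y : Atom} {L} → x ∈ L → y ∉ L → x ≢ y
∈-∉-≢ x∈ y∉ x≡y = y∉ (subst (_∈ _) x≡y x∈)

∉-∷⁻ : ∀ {x y : Atom} {ys} → x ∉ y ∷ ys → x ≢ y × x ∉ ys
∉-∷⁻ x∉ = x∉ ∘ here , x∉ ∘ there

∉-++⁻ : ∀ {x : Atom} xs {ys} → x ∉ xs ++ ys → x ∉ xs × x ∉ ys
∉-++⁻ xs x∉ = x∉ ∘ ∈-++⁺ˡ , x∉ ∘ ∈-++⁺ʳ xs

module PointsAlgebra (S : Signature) where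
  open Syntax S
  open ≡-Reasoning

  AtomFree : ∀ {n m} → (Fin n → Term m) → Set
  AtomFree σ = ∀ i c → c ∉ atomsT (σ i)

  mutual
    subst-idT : ∀ {n} {ρ : Atom → Term n} {σ : Fin n → Term n} (t : Term n)
              → (∀ a → a ∈ atomsT t → ρ a ≡ atm a) → (∀ i → σ i ≡ var i) → substT ρ σ t ≡ t
    subst-idT (var i)    hρ hσ = hσ i
    subst-idT (atm a)    hρ hσ = hρ a (here refl)
    subst-idT (fun f ts) hρ hσ = cong (fun f) (subst-idTs ts hρ hσ)

    subst-idTs : ∀ {n k} {ρ : Atom → Term n} {σ : Fin n → Term n} (ts : Vec (Term n) k)
               → (∀ a → a ∈ atomsTs ts → ρ a ≡ atm a) → (∀ i → σ i ≡ var i) → substTs ρ σ ts ≡ ts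
    subst-idTs []       hρ hσ = refl
    subst-idTs (t ∷ ts) hρ hσ =
      cong₂ _∷_ (subst-idT t (λ a → hρ a ∘ ∈-++⁺ˡ) hσ) (subst-idTs ts (λ a → hρ a ∘ ∈-++⁺ʳ (atomsT t)) hσ)

  lift-id : ∀ {n} {σ : Fin n → Term n} → (∀ i → σ i ≡ var i) → ∀ i → lift σ i ≡ var i
  lift-id hσ zero    = refl
  lift-id hσ (suc i) = cong wk (hσ i)

  subst-idF : ∀ {n} {ρ : Atom → Term n} {σ : Fin n → Term n} (φ : Formula n)
            → (∀ a → a ∈ atomsF φ → ρ a ≡ atm a) → (∀ i → σ i ≡ var i) → substF ρ σ φ ≡ φ
  subst-idF (t ≐ u)    hρ hσ =
    cong₂ _≐_ (subst-idT t (λ a → hρ a ∘ ∈-++⁺ˡ) hσ) (subst-idT u (λ a → hρ a ∘ ∈-++⁺ʳ (atomsT t)) hσ)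
  subst-idF (rel R ts) hρ hσ = cong (rel R) (subst-idTs ts hρ hσ)
  subst-idF ⊥'         hρ hσ = refl
  subst-idF (¬' φ)     hρ hσ = cong ¬'_ (subst-idF φ hρ hσ)
  subst-idF (φ ∧' ψ)   hρ hσ =
    cong₂ _∧'_ (subst-idF φ (λ a → hρ a ∘ ∈-++⁺ˡ) hσ) (subst-idF ψ (λ a → hρ a ∘ ∈-++⁺ʳ (atomsF φ)) hσ)
  subst-idF (∀' φ)     hρ hσ = cong ∀' (subst-idF φ (λ a m → cong wk (hρ a m)) (lift-id hσ))

  inj-id : (t : Term 0) → inj t ≡ t
  inj-id t = subst-idT t (λ _ _ → refl) (λ ())

  mutual
    subst-fuseT : ∀ {n m k} {ρ₁ : Atom → Term m} {σ₁ : Fin n → Term m}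
                    {ρ₂ : Atom → Term k} {σ₂ : Fin m → Term k} {ρ₃ : Atom → Term k} {σ₃ : Fin n → Term k}
                    (t : Term n)
                → (∀ a → a ∈ atomsT t → substT ρ₂ σ₂ (ρ₁ a) ≡ ρ₃ a) → (∀ i → substT ρ₂ σ₂ (σ₁ i) ≡ σ₃ i)
                → substT ρ₂ σ₂ (substT ρ₁ σ₁ t) ≡ substT ρ₃ σ₃ t
    subst-fuseT (var i)    hρ hσ = hσ i
    subst-fuseT (atm a)    hρ hσ = hρ a (here refl)
    subst-fuseT (fun f ts) hρ hσ = cong (fun f) (subst-fuseTs ts hρ hσ)

    subst-fuseTs : ∀ {n m k j} {ρ₁ : Atom → Term m} {σ₁ : Fin n → Term m}
                     {ρ₂ : Atom → Term k} {σ₂ : Fin m → Term k} {ρ₃ : Atom → Term k} {σ₃ : Fin n → Term k}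
                     (ts : Vec (Term n) j)
                 → (∀ a → a ∈ atomsTs ts → substT ρ₂ σ₂ (ρ₁ a) ≡ ρ₃ a) → (∀ i → substT ρ₂ σ₂ (σ₁ i) ≡ σ₃ i)
                 → substTs ρ₂ σ₂ (substTs ρ₁ σ₁ ts) ≡ substTs ρ₃ σ₃ ts
    subst-fuseTs []       hρ hσ = refl
    subst-fuseTs (t ∷ ts) hρ hσ =
      cong₂ _∷_ (subst-fuseT t (λ a → hρ a ∘ ∈-++⁺ˡ) hσ) (subst-fuseTs ts (λ a → hρ a ∘ ∈-++⁺ʳ (atomsT t)) hσ)

  -- Weakening commutes with substitution; this is what lets fusion pass under a binder.
  wk-commute : ∀ {m k} {ρ : Atom → Term k} {σ : Fin m → Term k} (t : Term m)
             → substT (λ a → wk (ρ a)) (lift σ) (wk t) ≡ wk (substT ρ σ t)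
  wk-commute t = trans (subst-fuseT t (λ _ _ → refl) (λ _ → refl)) (sym (subst-fuseT t (λ _ _ → refl) (λ _ → refl)))

  subst-fuseF : ∀ {n m k} {ρ₁ : Atom → Term m} {σ₁ : Fin n → Term m}
                  {ρ₂ : Atom → Term k} {σ₂ : Fin m → Term k} {ρ₃ : Atom → Term k} {σ₃ : Fin n → Term k}
                  (φ : Formula n)
              → (∀ a → a ∈ atomsF φ → substT ρ₂ σ₂ (ρ₁ a) ≡ ρ₃ a) → (∀ i → substT ρ₂ σ₂ (σ₁ i) ≡ σ₃ i)
              → substF ρ₂ σ₂ (substF ρ₁ σ₁ φ) ≡ substF ρ₃ σ₃ φ
  subst-fuseF (t ≐ u)    hρ hσ =
    cong₂ _≐_ (subst-fuseT t (λ a → hρ a ∘ ∈-++⁺ˡ) hσ) (subst-fuseT u (λ a → hρ a ∘ ∈-++⁺ʳ (atomsT t)) hσ)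
  subst-fuseF (rel R ts) hρ hσ = cong (rel R) (subst-fuseTs ts hρ hσ)
  subst-fuseF ⊥'         hρ hσ = refl
  subst-fuseF (¬' φ)     hρ hσ = cong ¬'_ (subst-fuseF φ hρ hσ)
  subst-fuseF (φ ∧' ψ)   hρ hσ =
    cong₂ _∧'_ (subst-fuseF φ (λ a → hρ a ∘ ∈-++⁺ˡ) hσ) (subst-fuseF ψ (λ a → hρ a ∘ ∈-++⁺ʳ (atomsF φ)) hσ)
  subst-fuseF {ρ₁ = ρ₁} {σ₁} {ρ₂} {σ₂} {σ₃ = σ₃} (∀' φ) hρ hσ =
    cong ∀' (subst-fuseF φ (λ a m → trans (wk-commute (ρ₁ a)) (cong wk (hρ a m))) lifted)
    where
      lifted : ∀ i → substT (λ a → wk (ρ₂ a)) (lift σ₂) (lift σ₁ i) ≡ lift σ₃ i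
      lifted zero    = refl
      lifted (suc i) = trans (wk-commute (σ₁ i)) (cong wk (hσ i))

  fuse-agree : ∀ {n m m' k} {ρ₁ : Atom → Term m} {σ₁ : Fin n → Term m} {ρ₂ : Atom → Term k} {σ₂ : Fin m → Term k}
                 {ρ₁' : Atom → Term m'} {σ₁' : Fin n → Term m'} {ρ₂' : Atom → Term k} {σ₂' : Fin m' → Term k}
                 (φ : Formula n)
             → (∀ a → a ∈ atomsF φ → substT ρ₂ σ₂ (ρ₁ a) ≡ substT ρ₂' σ₂' (ρ₁' a))
             → (∀ i → substT ρ₂ σ₂ (σ₁ i) ≡ substT ρ₂' σ₂' (σ₁' i))
             → substF ρ₂ σ₂ (substF ρ₁ σ₁ φ) ≡ substF ρ₂' σ₂' (substF ρ₁' σ₁' φ)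
  fuse-agree φ hρ hσ = trans (subst-fuseF φ hρ hσ) (sym (subst-fuseF φ (λ _ _ → refl) (λ _ → refl)))

  subst-congT : ∀ {n m} {ρ ρ' : Atom → Term m} {σ σ' : Fin n → Term m} (t : Term n)
              → (∀ a → a ∈ atomsT t → ρ a ≡ ρ' a) → (∀ i → σ i ≡ σ' i) → substT ρ σ t ≡ substT ρ' σ' t
  subst-congT {ρ = ρ} {σ = σ} t hρ hσ =
    trans (cong (substT ρ σ) (sym (subst-idT t (λ _ _ → refl) (λ _ → refl)))) (subst-fuseT t hρ hσ)

  mutual
    atoms-substT : ∀ {n m} {ρ : Atom → Term m} {σ : Fin n → Term m} → AtomFree σ
                 → (t : Term n) → ∀ {c} → c ∈ atomsT (substT ρ σ t) → Σ Atom λ a → a ∈ atomsT t × c ∈ atomsT (ρ a)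
    atoms-substT hσ (var i)    m = ⊥-elim (hσ i _ m)
    atoms-substT hσ (atm a)    m = a , here refl , m
    atoms-substT hσ (fun f ts) m = atoms-substTs hσ ts m

    atoms-substTs : ∀ {n m k} {ρ : Atom → Term m} {σ : Fin n → Term m} → AtomFree σ
                  → (ts : Vec (Term n) k) → ∀ {c} → c ∈ atomsTs (substTs ρ σ ts)
                  → Σ Atom λ a → a ∈ atomsTs ts × c ∈ atomsT (ρ a)
    atoms-substTs {ρ = ρ} {σ} hσ (t ∷ ts) m with ∈-++⁻ (atomsT (substT ρ σ t)) m
    ... | inj₁ m₁ = let (a , a∈ , c∈) = atoms-substT hσ t m₁ in a , ∈-++⁺ˡ a∈ , c∈
    ... | inj₂ m₂ = let (a , a∈ , c∈) = atoms-substTs hσ ts m₂ in a , ∈-++⁺ʳ (atomsT t) a∈ , c∈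

  atoms-wk : ∀ {m} (t : Term m) {c} → c ∈ atomsT (wk t) → c ∈ atomsT t
  atoms-wk t m with atoms-substT (λ i c ()) t m
  ... | (a , a∈ , here refl) = a∈

  lift-atomFree : ∀ {n m} {σ : Fin n → Term m} → AtomFree σ → AtomFree (lift σ)
  lift-atomFree hσ zero    c ()
  lift-atomFree {σ = σ} hσ (suc i) c m = hσ i c (atoms-wk (σ i) m)

  atoms-substF : ∀ {n m} {ρ : Atom → Term m} {σ : Fin n → Term m} → AtomFree σ
               → (φ : Formula n) → ∀ {c} → c ∈ atomsF (substF ρ σ φ) → Σ Atom λ a → a ∈ atomsF φ × c ∈ atomsT (ρ a)
  atoms-substF {ρ = ρ} {σ} hσ (t ≐ u) m with ∈-++⁻ (atomsT (substT ρ σ t)) m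
  ... | inj₁ m₁ = let (a , a∈ , c∈) = atoms-substT hσ t m₁ in a , ∈-++⁺ˡ a∈ , c∈
  ... | inj₂ m₂ = let (a , a∈ , c∈) = atoms-substT hσ u m₂ in a , ∈-++⁺ʳ (atomsT t) a∈ , c∈
  atoms-substF hσ (rel R ts) m = atoms-substTs hσ ts m
  atoms-substF hσ (¬' φ) m = atoms-substF hσ φ m
  atoms-substF {ρ = ρ} {σ} hσ (φ ∧' ψ) m with ∈-++⁻ (atomsF (substF ρ σ φ)) m
  ... | inj₁ m₁ = let (a , a∈ , c∈) = atoms-substF hσ φ m₁ in a , ∈-++⁺ˡ a∈ , c∈
  ... | inj₂ m₂ = let (a , a∈ , c∈) = atoms-substF hσ ψ m₂ in a , ∈-++⁺ʳ (atomsF φ) a∈ , c∈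
  atoms-substF {ρ = ρ} hσ (∀' φ) m =
    let (a , a∈ , c∈) = atoms-substF (lift-atomFree hσ) φ m in a , a∈ , atoms-wk (ρ a) c∈

  at-here : ∀ a s → at {0} a s a ≡ s
  at-here a s = trans (if-≡ᵇ-refl a) (inj-id s)

  at-elsewhere : ∀ {m} {a c} s → c ≢ a → at {m} a s c ≡ atm c
  at-elsewhere s = if-≡ᵇ-no

  bindAt : Atom → Atom → Term 1
  bindAt a c = if c ≡ᵇ a then var zero else atm c

  bindAt-here : ∀ a → bindAt a a ≡ var zero
  bindAt-here a = if-≡ᵇ-refl a

  bindAt-elsewhere : ∀ {a c} → c ≢ a → bindAt a c ≡ atm c
  bindAt-elsewhere = if-≡ᵇ-no

  bindAt-fresh : ∀ {σ : Fin 0 → Term 1} c r → c #ᵗ r → substT (bindAt c) σ r ≡ wk r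
  bindAt-fresh c r c#r = subst-congT r (λ x x∈ → bindAt-elsewhere (∈-∉-≢ x∈ c#r)) (λ ())

  inv : Perm → Perm
  inv π = record { to = from π ; from = to π ; from-to = to-from π ; to-from = from-to π
                 ; supp = supp π
                 ; fixes = λ a a∉ → trans (cong (from π) (sym (fixes π a a∉))) (from-to π a) }

  to-injective : ∀ π {x y} → to π x ≡ to π y → x ≡ y
  to-injective π {x} {y} e = trans (sym (from-to π x)) (trans (cong (from π) e) (from-to π y))

  perm-comp : ∀ π π' φ → π ·ᶠ (π' ·ᶠ φ) ≡ (π ∘ₚ π') ·ᶠ φ
  perm-comp π π' φ = subst-fuseF φ (λ _ _ → refl) (λ _ → refl)

  perm-id : ∀ φ → idPerm ·ᶠ φ ≡ φ
  perm-id φ = subst-idF φ (λ _ _ → refl) (λ _ → refl)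

  perm-inv-lᵗ : ∀ π u → inv π ·ᵗ (π ·ᵗ u) ≡ u
  perm-inv-lᵗ π u = trans (subst-fuseT u (λ _ _ → refl) (λ _ → refl))
                          (subst-idT u (λ a _ → cong atm (from-to π a)) (λ _ → refl))

  perm-inv-l : ∀ π φ → inv π ·ᶠ (π ·ᶠ φ) ≡ φ
  perm-inv-l π φ = trans (subst-fuseF φ (λ _ _ → refl) (λ _ → refl))
                         (subst-idF φ (λ a _ → cong atm (from-to π a)) (λ _ → refl))

  perm-inv-r : ∀ π φ → π ·ᶠ (inv π ·ᶠ φ) ≡ φ
  perm-inv-r π = perm-inv-l (inv π)

  -- The action of π on the body of a quantifier: π ·ᶠ ∀' φ is ∀' (π ·¹ φ).
  _·¹_ : Perm → Formula 1 → Formula 1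
  π ·¹ φ = substF (λ c → atm (to π c)) (lift var) φ

  perm-open : ∀ π φ r → π ·ᶠ open₀ r φ ≡ open₀ (π ·ᵗ r) (π ·¹ φ)
  perm-open π φ r = fuse-agree φ (λ _ _ → refl) (λ { zero → refl })

  perm-fresh : ∀ {n} {σ : Fin n → Term n} → AtomFree σ → ∀ π (φ : Formula n) {a}
             → a ∉ atomsF φ → to π a ∉ atomsF (substF (λ c → atm (to π c)) σ φ)
  perm-fresh hσ π φ a∉φ m with atoms-substF hσ φ m
  ... | x , x∈φ , here πa≡πx = a∉φ (subst (_∈ atomsF φ) (sym (to-injective π πa≡πx)) x∈φ)

  perm-fresh-ctx : ∀ π Γ {a} → a ∉ concatMap atomsF Γ → to π a ∉ concatMap atomsF (map (π ·ᶠ_) Γ)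
  perm-fresh-ctx π (φ ∷ Γ) a∉ m with ∈-++⁻ (atomsF (π ·ᶠ φ)) m
  ... | inj₁ m₁ = perm-fresh (λ i c ()) π φ (a∉ ∘ ∈-++⁺ˡ) m₁
  ... | inj₂ m₂ = perm-fresh-ctx π Γ (a∉ ∘ ∈-++⁺ʳ (atomsF φ)) m₂

  -- Permutations commute with swappings, binders and substitution, because an atom map that is
  -- injective respects the case distinctions x = a / x ≠ a made by these operations.
  swap-equivariant : ∀ π x y d → to π (swap x y d) ≡ swap (to π x) (to π y) (to π d)
  swap-equivariant π x y d with d ≟ x | d ≟ y
  ... | yes refl | _        = trans (cong (to π) (swap-left d y)) (sym (swap-left (to π d) (to π y)))
  ... | no _     | yes refl = trans (cong (to π) (swap-right x d)) (sym (swap-right (to π x) (to π d)))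
  ... | no d≢x   | no d≢y   = trans (cong (to π) (swap-fixes x y d d≢x d≢y))
                                    (sym (swap-fixes (to π x) (to π y) (to π d) (d≢x ∘ to-injective π) (d≢y ∘ to-injective π)))

  perm-swapF : ∀ π x y χ → π ·ᶠ swapF x y χ ≡ swapF (to π x) (to π y) (π ·ᶠ χ)
  perm-swapF π x y χ = fuse-agree χ (λ d _ → cong atm (swap-equivariant π x y d)) (λ _ → refl)

  perm-∀ : ∀ π a χ → π ·ᶠ (∀[ a ] χ) ≡ ∀[ to π a ] (π ·ᶠ χ)
  perm-∀ π a χ = cong ∀' (fuse-agree χ pointwise (λ ()))
    where
      pointwise : ∀ x → x ∈ atomsF χ → substT (λ c → wk (atm (to π c))) (lift var) (bindAt a x) ≡ bindAt (to π a) (to π x)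
      pointwise x _ with x ≟ a
      ... | yes refl = trans (cong (substT _ (lift var)) (bindAt-here x)) (sym (bindAt-here (to π x)))
      ... | no x≢a   = trans (cong (substT _ (lift var)) (bindAt-elsewhere x≢a)) (sym (bindAt-elsewhere (x≢a ∘ to-injective π)))

  perm-subst : ∀ π φ a u → π ·ᶠ (φ [ a ≔ u ]ᶠ) ≡ (π ·ᶠ φ) [ to π a ≔ π ·ᵗ u ]ᶠ
  perm-subst π φ a u = fuse-agree φ pointwise (λ _ → refl)
    where
      pointwise : ∀ x → x ∈ atomsF φ → π ·ᵗ at a u x ≡ at (to π a) (π ·ᵗ u) (to π x)
      pointwise x _ with x ≟ a
      ... | yes refl = trans (cong (π ·ᵗ_) (at-here x u)) (sym (at-here (to π x) (π ·ᵗ u)))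
      ... | no x≢a   = trans (cong (π ·ᵗ_) (at-elsewhere u x≢a)) (sym (at-elsewhere (π ·ᵗ u) (x≢a ∘ to-injective π)))

  swap-freshT : ∀ b c r → b #ᵗ r → c #ᵗ r → swapPerm b c ·ᵗ r ≡ r
  swap-freshT b c r b#r c#r =
    subst-idT r (λ x x∈ → cong atm (swap-fixes b c x (∈-∉-≢ x∈ b#r) (∈-∉-≢ x∈ c#r))) (λ _ → refl)

  swap-freshF : ∀ b c φ → b ∉ atomsF φ → c ∉ atomsF φ → swapF b c φ ≡ φ
  swap-freshF b c φ b∉ c∉ =
    subst-idF φ (λ x x∈ → cong atm (swap-fixes b c x (∈-∉-≢ x∈ b∉) (∈-∉-≢ x∈ c∉))) (λ _ → refl)

  subst-fresh : ∀ φ c u → c ∉ atomsF φ → φ [ c ≔ u ]ᶠ ≡ φ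
  subst-fresh φ c u c∉ = subst-idF φ (λ x x∈ → at-elsewhere u (∈-∉-≢ x∈ c∉)) (λ _ → refl)

  subst-self : ∀ a χ → χ [ a ≔ atm a ]ᶠ ≡ χ
  subst-self a χ = subst-idF χ pointwise (λ _ → refl)
    where
      pointwise : ∀ c → c ∈ atomsF χ → at a (atm a) c ≡ atm c
      pointwise c _ with c ≟ a
      ... | yes refl = at-here c (atm c)
      ... | no c≢a   = at-elsewhere (atm a) c≢a

  ∀-body : Formula 0 → Formula 1
  ∀-body (∀' φ) = φ
  ∀-body _      = ⊥'

  open-∀ : ∀ a χ r → open₀ r (∀-body (∀[ a ] χ)) ≡ χ [ a ≔ r ]ᶠ
  open-∀ a χ r = subst-fuseF χ (pointwise refl) (λ ())
    where
      pointwise : ∀ {σ : Fin 1 → Term 0} → σ zero ≡ r → ∀ c → c ∈ atomsF χ → substT atm σ (bindAt a c) ≡ at a r c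
      pointwise {σ} σ₀≡r c _ with c ≟ a
      ... | yes refl = trans (cong (substT atm σ) (bindAt-here c)) (trans σ₀≡r (sym (at-here c r)))
      ... | no c≢a   = trans (cong (substT atm σ) (bindAt-elsewhere c≢a)) (sym (at-elsewhere r c≢a))

  ∀-fresh : ∀ a χ → a ∉ atomsF (∀[ a ] χ)
  ∀-fresh a χ m with atoms-substF (λ ()) χ m
  ... | c , _ , a∈ with c ≟ a
  ...   | yes refl with subst (λ t → c ∈ atomsT t) (bindAt-here c) a∈
  ...     | ()
  ∀-fresh a χ m | c , _ , a∈ | no c≢a with subst (λ t → a ∈ atomsT t) (bindAt-elsewhere c≢a) a∈
  ...     | here a≡c = c≢a (sym a≡c)

  ∀-rename : ∀ a' φ c → c ∉ atomsF φ → ∀[ a' ] φ ≡ ∀[ c ] (swapF c a' φ)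
  ∀-rename a' φ c c∉φ = cong ∀' (sym (subst-fuseF φ pointwise (λ ())))
    where
      pointwise : ∀ x → x ∈ atomsF φ → bindAt c (swap c a' x) ≡ bindAt a' x
      pointwise x x∈ with x ≟ a'
      ... | yes refl = begin
              bindAt c (swap c x x) ≡⟨ cong (bindAt c) (swap-right c x) ⟩
              bindAt c c            ≡⟨ bindAt-here c ⟩
              var zero              ≡⟨ sym (bindAt-here x) ⟩
              bindAt x x            ∎
      ... | no x≢a' = begin
              bindAt c (swap c a' x) ≡⟨ cong (bindAt c) (swap-fixes c a' x x≢c x≢a') ⟩
              bindAt c x             ≡⟨ bindAt-elsewhere x≢c ⟩
              atm x                  ≡⟨ sym (bindAt-elsewhere x≢a') ⟩
              bindAt a' x            ∎
        where x≢c : x ≢ c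
              x≢c = ∈-∉-≢ x∈ c∉φ

  subst-under-∀ : ∀ a r c ψ → c ≢ a → c #ᵗ r → (∀[ c ] ψ) [ a ≔ r ]ᶠ ≡ ∀[ c ] (ψ [ a ≔ r ]ᶠ)
  subst-under-∀ a r c ψ c≢a c#r = cong ∀' (fuse-agree ψ (pointwise _) (λ ()))
    where
      pointwise : ∀ (σ : Fin 0 → Term 1) x → x ∈ atomsF ψ
                → substT (λ y → wk (at a r y)) (lift var) (bindAt c x) ≡ substT (bindAt c) σ (at a r x)
      pointwise σ x _ with x ≟ c | x ≟ a
      ... | yes refl | _ = begin
              substT _ (lift var) (bindAt x x) ≡⟨ cong (substT _ (lift var)) (bindAt-here x) ⟩
              var zero                         ≡⟨ sym (bindAt-here x) ⟩
              bindAt x x                       ≡⟨ cong (substT (bindAt x) σ) (sym (at-elsewhere r c≢a)) ⟩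
              substT (bindAt x) σ (at a r x)   ∎
      ... | no x≢c | yes refl = begin
              substT _ (lift var) (bindAt c x) ≡⟨ cong (substT _ (lift var)) (bindAt-elsewhere x≢c) ⟩
              wk (at x r x)                    ≡⟨ cong wk (at-here x r) ⟩
              wk r                             ≡⟨ sym (bindAt-fresh c r c#r) ⟩
              substT (bindAt c) σ r            ≡⟨ cong (substT (bindAt c) σ) (sym (at-here x r)) ⟩
              substT (bindAt c) σ (at x r x)   ∎
      ... | no x≢c | no x≢a = begin
              substT _ (lift var) (bindAt c x) ≡⟨ cong (substT _ (lift var)) (bindAt-elsewhere x≢c) ⟩
              wk (at a r x)                    ≡⟨ cong wk (at-elsewhere r x≢a) ⟩
              atm x                            ≡⟨ sym (bindAt-elsewhere x≢c) ⟩
              bindAt c x                       ≡⟨ cong (substT (bindAt c) σ) (sym (at-elsewhere r x≢a)) ⟩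
              substT (bindAt c) σ (at a r x)   ∎

  record FreshFor (c a a' : Atom) (r : Term 0) (φ : Formula 0) : Set where
    field
      ≢a  : c ≢ a
      ≢a' : c ≢ a'
      #r  : c #ᵗ r
      #φ  : c ∉ atomsF φ
  open FreshFor

  freshFor : ∀ {c a a' r φ} → c ∉ a ∷ a' ∷ atomsT r ++ atomsF φ → FreshFor c a a' r φ
  freshFor {r = r} c∉ =
    let (c≢a , c∉₁) = ∉-∷⁻ c∉ ; (c≢a' , c∉₂) = ∉-∷⁻ c∉₁ ; (c#r , c∉φ) = ∉-++⁻ (atomsT r) c∉₂
    in record { ≢a = c≢a ; ≢a' = c≢a' ; #r = c#r ; #φ = c∉φ }

  subst-∀ : ∀ a a' r φ c → FreshFor c a a' r φ → (∀[ a' ] φ) [ a ≔ r ]ᶠ ≡ ∀[ c ] ((swapF c a' φ) [ a ≔ r ]ᶠ)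
  subst-∀ a a' r φ c fc = trans (cong (_[ a ≔ r ]ᶠ) (∀-rename a' φ c (#φ fc))) (subst-under-∀ a r c _ (≢a fc) (#r fc))

  swap-swap : ∀ a' φ b c → b ≢ a' → c ≢ a' → b ∉ atomsF φ → c ∉ atomsF φ
            → swapF b c (swapF c a' φ) ≡ swapF b a' φ
  swap-swap a' φ b c b≢a' c≢a' b∉ c∉ = begin
      swapF b c (swapF c a' φ)
    ≡⟨ perm-swapF (swapPerm b c) c a' φ ⟩
      swapF (swap b c c) (swap b c a') (swapF b c φ)
    ≡⟨ cong₂ (λ x y → swapF x y (swapF b c φ)) (swap-right b c) (swap-fixes b c a' (≢-sym b≢a') (≢-sym c≢a')) ⟩
      swapF b a' (swapF b c φ)
    ≡⟨ cong (swapF b a') (swap-freshF b c φ b∉ c∉) ⟩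
      swapF b a' φ
    ∎

  swap-subst : ∀ a a' r φ b c → FreshFor b a a' r φ → FreshFor c a a' r φ
             → swapF b c ((swapF c a' φ) [ a ≔ r ]ᶠ) ≡ (swapF b a' φ) [ a ≔ r ]ᶠ
  swap-subst a a' r φ b c fb fc = begin
      swapF b c ((swapF c a' φ) [ a ≔ r ]ᶠ)
    ≡⟨ perm-subst (swapPerm b c) (swapF c a' φ) a r ⟩
      (swapF b c (swapF c a' φ)) [ swap b c a ≔ swapPerm b c ·ᵗ r ]ᶠ
    ≡⟨ cong₂ (λ x t → (swapF b c (swapF c a' φ)) [ x ≔ t ]ᶠ)
             (swap-fixes b c a (≢-sym (≢a fb)) (≢-sym (≢a fc))) (swap-freshT b c r (#r fb) (#r fc)) ⟩
      (swapF b c (swapF c a' φ)) [ a ≔ r ]ᶠ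
    ≡⟨ cong (_[ a ≔ r ]ᶠ) (swap-swap a' φ b c (≢a' fb) (≢a' fc) (#φ fb) (#φ fc)) ⟩
      (swapF b a' φ) [ a ≔ r ]ᶠ
    ∎

  subst-commute : ∀ φ u v a b → a ≢ b → a #ᵗ v
              → (φ [ a ≔ u ]ᶠ) [ b ≔ v ]ᶠ ≡ (φ [ b ≔ v ]ᶠ) [ a ≔ u [ b ≔ v ]ᵗ ]ᶠ
  subst-commute φ u v a b a≢b a#v = fuse-agree φ pointwise (λ _ → refl)
    where
      u' = u [ b ≔ v ]ᵗ
      pointwise : ∀ x → x ∈ atomsF φ → substT (at b v) var (at a u x) ≡ substT (at a u') var (at b v x)
      pointwise x _ with x ≟ a | x ≟ b
      ... | yes refl | _ = begin
              substT (at b v) var (at x u x)  ≡⟨ cong (substT (at b v) var) (at-here x u) ⟩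
              u'                              ≡⟨ sym (at-here x u') ⟩
              at x u' x                       ≡⟨ cong (substT (at x u') var) (sym (at-elsewhere v a≢b)) ⟩
              substT (at x u') var (at b v x) ∎
      ... | no x≢a | yes refl = begin
              substT (at x v) var (at a u x)  ≡⟨ cong (substT (at x v) var) (at-elsewhere u x≢a) ⟩
              at x v x                        ≡⟨ at-here x v ⟩
              v                               ≡⟨ sym (subst-idT v (λ y y∈ → at-elsewhere u' (∈-∉-≢ y∈ a#v)) λ _ → refl) ⟩
              substT (at a u') var v          ≡⟨ cong (substT (at a u') var) (sym (at-here x v)) ⟩
              substT (at a u') var (at x v x) ∎
      ... | no x≢a | no x≢b = begin
              substT (at b v) var (at a u x)  ≡⟨ cong (substT (at b v) var) (at-elsewhere u x≢a) ⟩
              at b v x                        ≡⟨ at-elsewhere v x≢b ⟩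
              atm x                           ≡⟨ sym (at-elsewhere u' x≢a) ⟩
              at a u' x                       ≡⟨ cong (substT (at a u') var) (sym (at-elsewhere v x≢b)) ⟩
              substT (at a u') var (at b v x) ∎

  ⊢-perm : ∀ π {Γ Δ} → Γ ⊢ Δ → map (π ·ᶠ_) Γ ⊢ map (π ·ᶠ_) Δ
  ⊢-perm π ax            = ax
  ⊢-perm π (str s t d)   = str (map⁺ (π ·ᶠ_) s) (map⁺ (π ·ᶠ_) t) (⊢-perm π d)
  ⊢-perm π (cut d e)     = cut (⊢-perm π d) (⊢-perm π e)
  ⊢-perm π ⊥L            = ⊥L
  ⊢-perm π (¬L d)        = ¬L (⊢-perm π d)
  ⊢-perm π (¬R d)        = ¬R (⊢-perm π d)
  ⊢-perm π (∧L d)        = ∧L (⊢-perm π d)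
  ⊢-perm π (∧R d e)      = ∧R (⊢-perm π d) (⊢-perm π e)
  ⊢-perm π (∀L {Γ} {Δ} {φ} r d) =
    ∀L (π ·ᵗ r) (subst (λ θ → θ ∷ map (π ·ᶠ_) Γ ⊢ map (π ·ᶠ_) Δ) (perm-open π φ r) (⊢-perm π d))
  ⊢-perm π (∀R {Γ} {Δ} {φ} a a∉Γ a∉Δ a∉φ d) =
    ∀R (to π a) (perm-fresh-ctx π Γ a∉Γ) (perm-fresh-ctx π Δ a∉Δ) (perm-fresh (lift-atomFree (λ i c ())) π φ a∉φ)
       (subst (λ θ → map (π ·ᶠ_) Γ ⊢ θ ∷ map (π ·ᶠ_) Δ) (perm-open π φ (atm a)) (⊢-perm π d))
  ⊢-perm π (=R r)        = =R (π ·ᵗ r)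
  ⊢-perm π (=sub {Γ} {Δ} φ r s d e) =
    subst (λ θ → map (π ·ᶠ_) Γ ⊢ θ ∷ map (π ·ᶠ_) Δ) (sym (perm-open π φ s))
      (=sub (π ·¹ φ) (π ·ᵗ r) (π ·ᵗ s) (⊢-perm π d)
        (subst (λ θ → map (π ·ᶠ_) Γ ⊢ θ ∷ map (π ·ᶠ_) Δ) (perm-open π φ r) (⊢-perm π e)))

  _⇒'_ : Formula 0 → Formula 0 → Formula 0
  φ ⇒' ψ = ¬' (φ ∧' (¬' ψ))

  ⊢-imp : ∀ {φ ψ} → φ ∷ [] ⊢ ψ ∷ [] → [] ⊢ (φ ⇒' ψ) ∷ []
  ⊢-imp {φ} {ψ} d = ¬R (∧L (str (⊆-reflexive-↭ (↭-swap (¬' ψ) φ ↭-refl)) ⊆-refl (¬L d)))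

  ⊢-unimp : ∀ {φ ψ} → [] ⊢ (φ ⇒' ψ) ∷ [] → φ ∷ [] ⊢ ψ ∷ []
  ⊢-unimp {φ} {ψ} d =
    cut (str (λ ()) (xs⊆xs++ys _ _) d)
        (¬L (∧R (str ⊆-refl (xs⊆xs++ys _ _) ax) (¬R (str (xs⊆xs++ys _ _) ⊆-refl ax))))

  -- Entailment is stable under substitution: ⊢ ∀a.(φ → ψ) by ∀R, then instantiate at r.
  ⊢-subst : ∀ {φ ψ} a r → φ ∷ [] ⊢ ψ ∷ [] → φ [ a ≔ r ]ᶠ ∷ [] ⊢ ψ [ a ≔ r ]ᶠ ∷ []
  ⊢-subst {φ} {ψ} a r d = ⊢-unimp (cut (str (λ ()) (xs⊆xs++ys _ _) generalised) instantiated)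
    where
      χ = φ ⇒' ψ
      generalised : [] ⊢ (∀[ a ] χ) ∷ []
      generalised = ∀R a (λ ()) (λ ()) (∀-fresh a χ)
        (subst (λ θ → [] ⊢ θ ∷ []) (sym (trans (open-∀ a χ (atm a)) (subst-self a χ))) (⊢-imp d))
      instantiated : (∀[ a ] χ) ∷ [] ⊢ (χ [ a ≔ r ]ᶠ) ∷ []
      instantiated = ∀L r (subst (λ θ → θ ∷ [] ⊢ (χ [ a ≔ r ]ᶠ) ∷ []) (sym (open-∀ a χ r)) ax)

  _≃_ : PSet → PSet → Set
  p ≃ q = ∀ φ → (p φ → q φ) × (q φ → p φ)

  ≃-isEquivalence : IsEquivalence _≃_
  ≃-isEquivalence = record
    { refl  = λ φ → (λ x → x) , (λ x → x)
    ; sym   = λ p≃q φ → proj₂ (p≃q φ) , proj₁ (p≃q φ)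
    ; trans = λ p≃q q≃r φ → proj₁ (q≃r φ) ∘ proj₁ (p≃q φ) , proj₂ (p≃q φ) ∘ proj₂ (q≃r φ) }

  prime-resp : ∀ {p q : PSet} → p ≃ q → IsPrimeFilter p → IsPrimeFilter q
  prime-resp {p} {q} p≃q P = record
    { isFilter = record
      { nonempty = let (φ , pφ) = nonempty in φ , to-q φ pφ
      ; no-⊥     = no-⊥ ∘ to-p ⊥'
      ; ded      = λ φ ψ qφ d → to-q ψ (ded φ ψ (to-p φ qφ) d)
      ; ∧-closed = λ φ ψ qφ qψ → to-q _ (∧-closed φ ψ (to-p φ qφ) (to-p ψ qψ))
      ; ∀-closed = λ { a φ (L , qs) → to-q _ (∀-closed a φ (L , λ b b∉ → to-p _ (qs b b∉))) } }
    ; prime = λ φ₁ φ₂ q∨ → ⊎-map (to-q φ₁) (to-q φ₂) (prime φ₁ φ₂ (to-p _ q∨)) }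
    where
      open IsPrimeFilter P
      open IsFilter isFilter
      to-q : ∀ φ → p φ → q φ
      to-q φ = proj₁ (p≃q φ)
      to-p : ∀ φ → q φ → p φ
      to-p φ = proj₂ (p≃q φ)

  pullback-prime : ∀ {p : PSet} (ρ : Atom → Term 0)
    → (∀ {φ ψ} → φ ∷ [] ⊢ ψ ∷ [] → substF ρ var φ ∷ [] ⊢ substF ρ var ψ ∷ [])
    → (∀ a φ → N (λ b → p (substF ρ var (swapF b a φ))) → p (substF ρ var (∀[ a ] φ)))
    → IsPrimeFilter p → IsPrimeFilter (λ φ → p (substF ρ var φ))
  pullback-prime ρ ⊢-ρ ∀-ρ P = record
    { isFilter = record
      { nonempty = ¬' ⊥' , has-⊤
      ; no-⊥     = no-⊥
      ; ded      = λ φ ψ pφ d → ded _ _ pφ (⊢-ρ d)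
      ; ∧-closed = λ φ ψ → ∧-closed _ _
      ; ∀-closed = ∀-ρ }
    ; prime = λ φ₁ φ₂ → prime _ _ }
    where
      open IsPrimeFilter P
      open IsFilter isFilter
      has-⊤ = let (φ , pφ) = nonempty in ded φ (¬' ⊥') pφ (¬R ⊥L)

  -- ∀-closure transported along a substitution: rename the bound atom to a fresh c,
  -- push the substitution under the binder and recognise the swapped instances.
  subst-∀-closed : ∀ {p} → IsFilter p → ∀ a r a' φ
                 → N (λ b → p ((swapF b a' φ) [ a ≔ r ]ᶠ)) → p ((∀[ a' ] φ) [ a ≔ r ]ᶠ)
  subst-∀-closed {p} F a r a' φ (L , instances) =
    subst p (sym (subst-∀ a a' r φ c c-fresh)) (IsFilter.∀-closed F c ψ (L ++ K , swapped-instance))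
    where
      K = a ∷ a' ∷ atomsT r ++ atomsF φ
      c = fresh K
      c-fresh : FreshFor c a a' r φ
      c-fresh = freshFor (fresh-∉ K)
      ψ = (swapF c a' φ) [ a ≔ r ]ᶠ
      swapped-instance : ∀ b → b ∉ L ++ K → p (swapF b c ψ)
      swapped-instance b b∉ =
        let (b∉L , b∉K) = ∉-++⁻ L b∉
        in subst p (sym (swap-subst a a' r φ b c (freshFor b∉K) c-fresh)) (instances b b∉L)

  -- ∀-closure transported along a permutation: the instance at b is the π-image of the one at π⁻¹ b.
  perm-∀-closed : ∀ {p} → IsFilter p → ∀ π a φ → N (λ b → p (π ·ᶠ swapF b a φ)) → p (π ·ᶠ (∀[ a ] φ))
  perm-∀-closed {p} F π a φ (L , instances) =
    subst p (sym (perm-∀ π a φ)) (IsFilter.∀-closed F (to π a) (π ·ᶠ φ) (map (to π) L , renamed))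
    where
      renamed : ∀ b → b ∉ map (to π) L → p (swapF b (to π a) (π ·ᶠ φ))
      renamed b b∉ =
        subst p (trans (perm-swapF π (from π b) a φ) (cong (λ x → swapF x (to π a) (π ·ᶠ φ)) (to-from π b)))
          (instances (from π b) (λ m → b∉ (subst (_∈ map (to π) L) (to-from π b) (∈-map⁺ (to π) m))))

  ·ₚ-intro : ∀ π p φ → p (inv π ·ᶠ φ) → (π ·ₚ p) φ
  ·ₚ-intro π p φ pφ = inv π ·ᶠ φ , pφ , sym (perm-inv-r π φ)

  ·ₚ-elim : ∀ π p φ → (π ·ₚ p) φ → p (inv π ·ᶠ φ)
  ·ₚ-elim π p _ (φ , pφ , refl) = subst p (sym (perm-inv-l π φ)) pφ

  -- Points are closed under both actions: p[r⇐a] is the pullback along [a:=r], and π·p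
  -- is extensionally the pullback along π⁻¹.
  subst-point : ∀ p r a → IsPrimeFilter p → IsPrimeFilter (p [ r ⇐ a ]ₚ)
  subst-point p r a P = pullback-prime (at a r) (⊢-subst a r) (subst-∀-closed (IsPrimeFilter.isFilter P) a r) P

  perm-point : ∀ π p → IsPrimeFilter p → IsPrimeFilter (π ·ₚ p)
  perm-point π p P =
    prime-resp (λ φ → ·ₚ-intro π p φ , ·ₚ-elim π p φ)
      (pullback-prime (λ c → atm (from π c)) (⊢-perm (inv π)) (perm-∀-closed (IsPrimeFilter.isFilter P) (inv π)) P)

  points-closed : PointsClosed
  points-closed = perm-point , subst-point

  ·ₚ-cong : ∀ π {p q} → p ≃ q → (π ·ₚ p) ≃ (π ·ₚ q)
  ·ₚ-cong π p≃q ψ = (λ { (φ , pφ , e) → φ , proj₁ (p≃q φ) pφ , e })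
                  , (λ { (φ , qφ , e) → φ , proj₂ (p≃q φ) qφ , e })

  ⇐-cong : ∀ {p q} u a → p ≃ q → (p [ u ⇐ a ]ₚ) ≃ (q [ u ⇐ a ]ₚ)
  ⇐-cong u a p≃q φ = p≃q (φ [ a ≔ u ]ᶠ)

  ·ₚ-id : ∀ p → (idPerm ·ₚ p) ≃ p
  ·ₚ-id p ψ = (λ { (φ , pφ , refl) → subst p (sym (perm-id φ)) pφ })
            , (λ pψ → ψ , pψ , sym (perm-id ψ))

  ·ₚ-comp : ∀ π π' p → ((π ∘ₚ π') ·ₚ p) ≃ (π ·ₚ (π' ·ₚ p))
  ·ₚ-comp π π' p ψ = (λ { (φ , pφ , refl) → π' ·ᶠ φ , (φ , pφ , refl) , sym (perm-comp π π' φ) })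
                   , (λ { (_ , (φ , pφ , refl) , refl) → φ , pφ , perm-comp π π' φ })

  -- Equivariance of p[u⇐a]: both sides contain φ iff p contains (π⁻¹·φ)[a:=u].
  ⇐-equivariant : ∀ π p u a → (π ·ₚ (p [ u ⇐ a ]ₚ)) ≃ ((π ·ₚ p) [ π ·ᵗ u ⇐ to π a ]ₚ)
  ⇐-equivariant π p u a φ =
      (λ m → ·ₚ-intro π p _ (subst p (sym pulled-back) (·ₚ-elim π (p [ u ⇐ a ]ₚ) φ m)))
    , (λ m → ·ₚ-intro π (p [ u ⇐ a ]ₚ) φ (subst p pulled-back (·ₚ-elim π p _ m)))
    where
      pulled-back : inv π ·ᶠ (φ [ to π a ≔ π ·ᵗ u ]ᶠ) ≡ (inv π ·ᶠ φ) [ a ≔ u ]ᶠ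
      pulled-back = trans (perm-subst (inv π) φ (to π a) (π ·ᵗ u))
                          (cong₂ (λ x t → (inv π ·ᶠ φ) [ x ≔ t ]ᶠ) (from-to π a) (perm-inv-lᵗ π u))

  ⇐-amgis : ∀ p u v a b → a ≢ b → a #ᵗ v
          → ((p [ v ⇐ b ]ₚ) [ u ⇐ a ]ₚ) ≃ ((p [ u [ b ≔ v ]ᵗ ⇐ a ]ₚ) [ v ⇐ b ]ₚ)
  ⇐-amgis p u v a b a≢b a#v φ = subst p commute , subst p (sym commute)
    where commute = subst-commute φ u v a b a≢b a#v

  -- Exactness: p[u⇐c] = q[u⇐c] for a c fresh for φ already decides φ, as φ[c:=u] = φ.
  ⇐-exact : ∀ p q u → N (λ c → (p [ u ⇐ c ]ₚ) ≃ (q [ u ⇐ c ]ₚ)) → p ≃ q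
  ⇐-exact p q u (L , agree) φ =
      (λ pφ → subst q unchanged (proj₁ (agree c c∉L φ) (subst p (sym unchanged) pφ)))
    , (λ qφ → subst p unchanged (proj₂ (agree c c∉L φ) (subst q (sym unchanged) qφ)))
    where
      c = fresh (L ++ atomsF φ)
      c-fresh = ∉-++⁻ L (fresh-∉ (L ++ atomsF φ))
      c∉L = proj₁ c-fresh
      unchanged = subst-fresh φ c u (proj₂ c-fresh)

proposition7p24 : (S : Signature) → let open Syntax S in
    Σ PointsClosed (λ cl → IsAmgisAlgebra (PointsData cl) × IsExact (PointsData cl))
proposition7p24 S = points-closed , isAmgisAlgebra , λ p q u → ⇐-exact (proj₁ p) (proj₁ q) u
  where
    open Syntax S
    open PointsAlgebra S
    isAmgisAlgebra : IsAmgisAlgebra (PointsData points-closed)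
    isAmgisAlgebra = record
      { isEquivalence = On.isEquivalence proj₁ ≃-isEquivalence
      ; ∙-cong        = λ π → ·ₚ-cong π
      ; ⇐-cong        = ⇐-cong
      ; ∙-id          = λ p → ·ₚ-id (proj₁ p)
      ; ∙-comp        = λ π π' p → ·ₚ-comp π π' (proj₁ p)
      ; equivar       = λ π p → ⇐-equivariant π (proj₁ p)
      ; amgis         = λ p → ⇐-amgis (proj₁ p)
      }
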